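{- Let $\gamma$ be an umbra and, for $m\ge0$, define the polynomial $K_m\in\mathbf{k}[a_1,\dots,a_m]$ by $K_m(a_1,\dots,a_m)=\sum_{j=0}^m c_{m,j}a_j$ (with $a_0=1$), where $q_{\gamma,m}(n)=\sum_{j=0}^m c_{m,j}n^j$; equivalently, $K_m(a_1,\dots,a_m)\simeq(\alpha.\gamma)^m$ whenever $\alpha$ is an umbra with $\alpha^i\simeq a_i$ for all $i$. If sequences $a_i$, $b_j$, $c_k$ (with $a_0=b_0=c_0=1$) satisfy \[ \sum_{k\ge0}c_k\frac{z^k}{k!}=\Big(\sum_{i\ge0}a_i\frac{z^i}{i!}\Big)\Big(\sum_{j\ge0}b_j\frac{z^j}{j!}\Big), \] then \[ \sum_{k\ge0}K_k(c_1,\dots,c_k)\frac{z^k}{k!}=\Big(\sum_{i\ge0}K_i(a_1,\dots,a_i)\frac{z^i}{i!}\Big)\Big(\sum_{j\ge0}K_j(b_1,\dots,b_j)\frac{z^j}{j!}\Big). \]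
   Context: Let $\mathbf{k}$ be a commutative ring containing $\mathbb{Q}$. Umbrae are formal symbols; the polynomial ring in the umbrae carries a linear evaluation map $\mathbf{E}$ with $\mathbf{E}[1]=1$ and $\mathbf{E}[MM']=\mathbf{E}[M]\mathbf{E}[M']$ for monomials with no umbra in common; every sequence $1,a_1,a_2,\dots$ is represented by infinitely many umbrae. Write $p\simeq q$ if $\mathbf{E}[p]=\mathbf{E}[q]$. For an umbra $\gamma$, let $g(z)=\sum_{k\ge0}\mathbf{E}[\gamma^k]z^k/k!$ and let $q_{\gamma,k}(n)$ be the coefficient of $z^k/k!$ in $\exp(n\log g(z))$, a polynomial in $n$ of degree at most $k$. For an umbra $\alpha$, $\alpha.\gamma$ is a new umbra with $(\alpha.\gamma)^k\simeq q_{\gamma,k}(\alpha)$ for all $k$. -}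

module Defs where

open import Level using (Level)
open import Data.Nat using (ℕ; zero; suc; _∸_)
open import Data.Nat.Combinatorics using (_C_)
open import Algebra.Bundles using (CommutativeRing)

-- All definitions are relative to a commutative ring R together with a
-- function inv : ℕ → R which (by hypothesis in the theorem) satisfies
-- (n+1) · inv n ≈ 1, i.e. R contains ℚ (every positive integer is a unit).
module Setup {c ℓ : Level} (R : CommutativeRing c ℓ) (inv : ℕ → CommutativeRing.Carrier R) where
  open CommutativeRing R

  natToR : ℕ → Carrier
  natToR zero = 0#
  natToR (suc n) = 1# + natToR n

  sumTo : ℕ → (ℕ → Carrier) → Carrier
  sumTo zero f = f 0
  sumTo (suc n) f = sumTo n f + f (suc n)

  -- formal power series (ordinary coefficients) : ℕ → Carrier
  -- Cauchy product
  conv : (ℕ → Carrier) → (ℕ → Carrier) → ℕ → Carrier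
  conv f h k = sumTo k (λ i → f i * h (k ∸ i))

  one : ℕ → Carrier
  one zero = 1#
  one (suc _) = 0#

  pow : (ℕ → Carrier) → ℕ → ℕ → Carrier
  pow f zero = one
  pow f (suc r) = conv f (pow f r)

  -- 1 / n!  (inv i = 1/(i+1))
  invFact : ℕ → Carrier
  invFact zero = 1#
  invFact (suc n) = inv n * invFact n

  sign : ℕ → Carrier
  sign zero = 1#
  sign (suc r) = - sign r

  -- g is an exponential generating function given by its sequence
  -- g k = E[γ^k]  (so the series is Σ g k z^k/k!), with g 0 = 1.
  -- ordinary coefficients of g(z) - 1
  gMinusOne : (ℕ → Carrier) → ℕ → Carrier
  gMinusOne g zero = 0#
  gMinusOne g (suc k) = g (suc k) * invFact (suc k)

  -- ordinary coefficients of log g(z) = Σ_{r≥1} (-1)^{r+1} (g(z)-1)^r / r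
  -- (the coefficient of z^m only involves r ≤ m)
  logSeries : (ℕ → Carrier) → ℕ → Carrier
  logSeries g m = sumTo m term
    where
      term : ℕ → Carrier
      term zero = 0#
      term (suc r) = sign r * inv r * pow (gMinusOne g) (suc r) m

  -- exp(n log g(z)) = Σ_j n^j (log g(z))^j / j!.  Hence the coefficient
  -- of z^m/m! is q_{γ,m}(n) = Σ_{j=0}^m qCoeff g m j · n^j with
  -- qCoeff g m j = m! · [z^m] (log g)^j / j!.
  qCoeff : (ℕ → Carrier) → ℕ → ℕ → Carrier
  qCoeff g m j = natToR (fact m) * invFact j * pow (logSeries g) j m
    where
      fact : ℕ → ℕ
      fact zero = 1
      fact (suc n) = suc n Data.Nat.* fact n

  q : (ℕ → Carrier) → ℕ → Carrier → Carrier
  q g m x = sumTo m (λ j → qCoeff g m j * xpow j)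
    where
      xpow : ℕ → Carrier
      xpow zero = 1#
      xpow (suc j) = x * xpow j

  -- K_m(a_1,…,a_m) = Σ_{j=0}^m c_{m,j} a_j  (a 0 plays the role of a_0 = 1)
  K : (ℕ → Carrier) → (ℕ → Carrier) → ℕ → Carrier
  K g a m = sumTo m (λ j → qCoeff g m j * a j)

  -- coefficients of the product of exponential generating functions:
  -- (Σ f_i z^i/i!)(Σ h_j z^j/j!) = Σ_k egfMul f h k z^k/k!
  egfMul : (ℕ → Carrier) → (ℕ → Carrier) → ℕ → Carrier
  egfMul f h k = sumTo k (λ i → natToR (k C i) * f i * h (k ∸ i))

{-# OPTIONS --safe #-}
-- Write A(z) = Σ aᵢ zⁱ/i! and L = log g. Expanding exp(nL) = Σⱼ nʲ Lʲ/j! and replacing nʲ by aⱼ shows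
-- Σₘ Kₘ(a) zᵐ/m! = Σⱼ (aⱼ/j!) L(z)ʲ = A(L(z)). Since L has no constant term, composition with L is
-- multiplicative, (AB)∘L = (A∘L)(B∘L), which is the claim. Over a ring containing ℚ, products of
-- exponential generating functions are Cauchy products of the ordinary coefficients fᵢ/i!.
module Submission where

open import Defs
open import Data.Nat using (ℕ; suc)
open import Algebra.Bundles using (CommutativeRing)

import Data.Nat as ℕ
open import Data.Nat using (zero; _!; _≤_; _<_; z≤n; s≤s; _∸_)
open import Data.Nat.Properties
  using (≤-refl; m≤n⇒m≤1+n; m≤n⇒m<n∨m≡n; <-≤-trans; ∸-monoʳ-<; m∸n≤m; +-monoʳ-<;
         +-∸-assoc; n∸n≡0; ∸-+-assoc; m+[n∸m]≡n; _!*_!≢0)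
open import Data.Nat.Combinatorics using (_C_; nCk≡n!/k![n-k]!; k![n∸k]!∣n!)
open import Data.Nat.DivMod using (m/n*n≡m)
open import Data.Sum using (inj₁; inj₂)
open import Function using (_∘_)
import Relation.Binary.PropositionalEquality as ≡
open ≡ using (_≡_)

factorial-unique : (h : ℕ → ℕ) → h 0 ≡ 1 → (∀ n → h (suc n) ≡ suc n ℕ.* h n) → ∀ n → h n ≡ n !
factorial-unique h h0 hs zero = h0
factorial-unique h h0 hs (suc n) = ≡.trans (hs n) (≡.cong (suc n ℕ.*_) (factorial-unique h h0 hs n))

nCk*[k!*[n∸k]!]≡n! : ∀ {n k} → k ≤ n → (n C k) ℕ.* (k ! ℕ.* (n ∸ k) !) ≡ n !
nCk*[k!*[n∸k]!]≡n! {n} {k} k≤n =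
  ≡.trans (≡.cong (ℕ._* (k ! ℕ.* (n ∸ k) !)) (nCk≡n!/k![n-k]! k≤n))
          (m/n*n≡m {{k !* (n ∸ k) !≢0}} (k![n∸k]!∣n! k≤n))

module SeriesAlgebra {c ℓ} (R : CommutativeRing c ℓ) (inv : ℕ → CommutativeRing.Carrier R) where
  open CommutativeRing R hiding (zero)
  open Setup R inv
  open import Relation.Binary.Reasoning.Setoid setoid
  open import Algebra.Properties.CommutativeSemigroup *-commutativeSemigroup using (interchange)
  open import Algebra.Properties.CommutativeSemigroup +-commutativeSemigroup
    using () renaming (interchange to +-interchange)
  open import Algebra.Solver.CommutativeMonoid *-commutativeMonoid using (solve; _⊜_; _⊕_)

  sumTo-cong : ∀ n {f h : ℕ → Carrier} → (∀ i → i ≤ n → f i ≈ h i) → sumTo n f ≈ sumTo n h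
  sumTo-cong zero f≈h = f≈h 0 z≤n
  sumTo-cong (suc n) f≈h =
    +-cong (sumTo-cong n (λ i i≤n → f≈h i (m≤n⇒m≤1+n i≤n))) (f≈h (suc n) ≤-refl)

  sumTo-distrib-+ : ∀ n (f h : ℕ → Carrier) → sumTo n (λ i → f i + h i) ≈ sumTo n f + sumTo n h
  sumTo-distrib-+ zero f h = refl
  sumTo-distrib-+ (suc n) f h = trans (+-congʳ (sumTo-distrib-+ n f h)) (+-interchange _ _ _ _)

  *-distribˡ-sumTo : ∀ n x (f : ℕ → Carrier) → x * sumTo n f ≈ sumTo n (λ i → x * f i)
  *-distribˡ-sumTo zero x f = refl
  *-distribˡ-sumTo (suc n) x f = trans (distribˡ x _ _) (+-congʳ (*-distribˡ-sumTo n x f))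

  *-distribʳ-sumTo : ∀ n x (f : ℕ → Carrier) → sumTo n f * x ≈ sumTo n (λ i → f i * x)
  *-distribʳ-sumTo zero x f = refl
  *-distribʳ-sumTo (suc n) x f = trans (distribʳ x _ _) (+-congʳ (*-distribʳ-sumTo n x f))

  sumTo-vanishing : ∀ n {f : ℕ → Carrier} → (∀ i → i ≤ n → f i ≈ 0#) → sumTo n f ≈ 0#
  sumTo-vanishing zero f≈0 = f≈0 0 z≤n
  sumTo-vanishing (suc n) f≈0 =
    trans (+-cong (sumTo-vanishing n (λ i i≤n → f≈0 i (m≤n⇒m≤1+n i≤n))) (f≈0 (suc n) ≤-refl))
          (+-identityʳ 0#)

  sumTo-extend : ∀ {n} m (f : ℕ → Carrier) → n ≤ m → (∀ i → n < i → f i ≈ 0#) → sumTo m f ≈ sumTo n f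
  sumTo-extend zero f z≤n _ = refl
  sumTo-extend (suc m) f n≤1+m f≈0 with m≤n⇒m<n∨m≡n n≤1+m
  ... | inj₁ (s≤s n≤m) = trans (+-cong (sumTo-extend m f n≤m f≈0) (f≈0 (suc m) (s≤s n≤m))) (+-identityʳ _)
  ... | inj₂ ≡.refl    = refl

  sumTo-comm : ∀ n m (F : ℕ → ℕ → Carrier) →
    sumTo n (λ i → sumTo m (F i)) ≈ sumTo m (λ j → sumTo n (λ i → F i j))
  sumTo-comm zero m F = refl
  sumTo-comm (suc n) m F = trans (+-congʳ (sumTo-comm n m F)) (sym (sumTo-distrib-+ m _ _))

  -- Both sides enumerate the pairs (j , l) with j + l ≤ k.
  sumTo-triangle : ∀ k (F : ℕ → ℕ → Carrier) →
    sumTo k (λ i → sumTo i (λ j → F j (i ∸ j))) ≈ sumTo k (λ j → sumTo (k ∸ j) (F j))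
  sumTo-triangle zero F = refl
  sumTo-triangle (suc k) F = begin
      sumTo k (λ i → sumTo i (λ j → F j (i ∸ j))) + (sumTo k (λ j → F j (suc k ∸ j)) + F (suc k) (k ∸ k))
    ≈⟨ +-congʳ (sumTo-triangle k F) ⟩
      sumTo k (λ j → sumTo (k ∸ j) (F j)) + (sumTo k (λ j → F j (suc k ∸ j)) + F (suc k) (k ∸ k))
    ≈⟨ sym (+-assoc _ _ _) ⟩
      (sumTo k (λ j → sumTo (k ∸ j) (F j)) + sumTo k (λ j → F j (suc k ∸ j))) + F (suc k) (k ∸ k)
    ≈⟨ +-congʳ (sym (sumTo-distrib-+ k _ _)) ⟩
      sumTo k (λ j → sumTo (k ∸ j) (F j) + F j (suc k ∸ j)) + F (suc k) (k ∸ k)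
    ≈⟨ +-cong (sumTo-cong k grow-row) last-row ⟩
      sumTo k (λ j → sumTo (suc k ∸ j) (F j)) + sumTo (k ∸ k) (F (suc k))
    ∎
    where
      grow-row : ∀ j → j ≤ k → sumTo (k ∸ j) (F j) + F j (suc k ∸ j) ≈ sumTo (suc k ∸ j) (F j)
      grow-row j j≤k rewrite +-∸-assoc 1 j≤k = refl

      last-row : F (suc k) (k ∸ k) ≈ sumTo (k ∸ k) (F (suc k))
      last-row rewrite n∸n≡0 k = refl

  conv-cong : ∀ {f f′ h h′ : ℕ → Carrier} → (∀ i → f i ≈ f′ i) → (∀ i → h i ≈ h′ i) →
    ∀ k → conv f h k ≈ conv f′ h′ k
  conv-cong f≈f′ h≈h′ k = sumTo-cong k (λ i _ → *-cong (f≈f′ i) (h≈h′ (k ∸ i)))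

  conv-identityˡ : ∀ (h : ℕ → Carrier) k → conv one h k ≈ h k
  conv-identityˡ h k = partial k
    where
      partial : ∀ n → sumTo n (λ i → one i * h (k ∸ i)) ≈ h k
      partial zero = *-identityˡ (h k)
      partial (suc n) = trans (+-cong (partial n) (zeroˡ _)) (+-identityʳ _)

  conv-assoc : ∀ (f g h : ℕ → Carrier) k → conv (conv f g) h k ≈ conv f (conv g h) k
  conv-assoc f g h k = begin
      sumTo k (λ i → sumTo i (λ j → f j * g (i ∸ j)) * h (k ∸ i))
    ≈⟨ sumTo-cong k (λ i _ → *-distribʳ-sumTo i _ _) ⟩
      sumTo k (λ i → sumTo i (λ j → f j * g (i ∸ j) * h (k ∸ i)))
    ≈⟨ sumTo-cong k (λ i _ → sumTo-cong i (λ j j≤i →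
         reflexive (≡.cong (λ t → f j * g (i ∸ j) * h t) (k∸i≡k∸j∸[i∸j] j≤i)))) ⟩
      sumTo k (λ i → sumTo i (λ j → F j (i ∸ j)))
    ≈⟨ sumTo-triangle k F ⟩
      sumTo k (λ j → sumTo (k ∸ j) (F j))
    ≈⟨ sumTo-cong k (λ j _ → trans (sumTo-cong (k ∸ j) (λ l _ → *-assoc _ _ _))
                                   (sym (*-distribˡ-sumTo (k ∸ j) (f j) _))) ⟩
      sumTo k (λ j → f j * sumTo (k ∸ j) (λ l → g l * h (k ∸ j ∸ l)))
    ∎
    where
      F : ℕ → ℕ → Carrier
      F j l = f j * g l * h (k ∸ j ∸ l)

      k∸i≡k∸j∸[i∸j] : ∀ {i j} → j ≤ i → k ∸ i ≡ k ∸ j ∸ (i ∸ j)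
      k∸i≡k∸j∸[i∸j] {i} {j} j≤i = ≡.sym (≡.trans (∸-+-assoc k j (i ∸ j)) (≡.cong (k ∸_) (m+[n∸m]≡n j≤i)))

  pow-+ : ∀ (L : ℕ → Carrier) p q k → conv (pow L p) (pow L q) k ≈ pow L (p ℕ.+ q) k
  pow-+ L zero q k = conv-identityˡ (pow L q) k
  pow-+ L (suc p) q k =
    trans (conv-assoc L (pow L p) (pow L q) k) (conv-cong (λ _ → refl) (λ i → pow-+ L p q i) k)

  pow-vanishes : ∀ {L : ℕ → Carrier} → L 0 ≈ 0# → ∀ {j m} → m < j → pow L j m ≈ 0#
  pow-vanishes {L} L0 {suc j} {m} (s≤s m≤j) = sumTo-vanishing m term≈0
    where
      term≈0 : ∀ i → i ≤ m → L i * pow L j (m ∸ i) ≈ 0#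
      term≈0 zero    _     = trans (*-congʳ L0) (zeroˡ _)
      term≈0 (suc i) 1+i≤m =
        trans (*-congˡ (pow-vanishes L0 (<-≤-trans (∸-monoʳ-< (s≤s z≤n) 1+i≤m) m≤j))) (zeroʳ _)

  -- The coefficient of zᵏ in Σⱼ αⱼ L(z)ʲ, the sum stopping at j = k because L 0 ≈ 0# in all uses.
  compose : (ℕ → Carrier) → (ℕ → Carrier) → ℕ → Carrier
  compose α L k = sumTo k (λ j → α j * pow L j k)

  compose-cong : ∀ {α α′ : ℕ → Carrier} {L} → (∀ j → α j ≈ α′ j) → ∀ k → compose α L k ≈ compose α′ L k
  compose-cong α≈α′ k = sumTo-cong k (λ j _ → *-congʳ (α≈α′ j))

  compose-extend : ∀ {L : ℕ → Carrier} → L 0 ≈ 0# → ∀ α {k n} → k ≤ n →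
    compose α L k ≈ sumTo n (λ j → α j * pow L j k)
  compose-extend L0 α {k} {n} k≤n =
    sym (sumTo-extend n _ k≤n (λ j k<j → trans (*-congˡ (pow-vanishes L0 k<j)) (zeroʳ _)))

  module _ {L : ℕ → Carrier} (L0 : L 0 ≈ 0#) (α β : ℕ → Carrier) (k : ℕ) where

    compose-conv-expand :
      compose (conv α β) L k ≈ sumTo k (λ p → sumTo k (λ q → α p * β q * pow L (p ℕ.+ q) k))
    compose-conv-expand = begin
        sumTo k (λ j → sumTo j (λ p → α p * β (j ∸ p)) * pow L j k)
      ≈⟨ sumTo-cong k (λ j _ → *-distribʳ-sumTo j _ _) ⟩
        sumTo k (λ j → sumTo j (λ p → α p * β (j ∸ p) * pow L j k))
      ≈⟨ sumTo-cong k (λ j _ → sumTo-cong j (λ p p≤j →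
           reflexive (≡.cong (λ t → α p * β (j ∸ p) * pow L t k) (≡.sym (m+[n∸m]≡n p≤j))))) ⟩
        sumTo k (λ j → sumTo j (λ p → G p (j ∸ p)))
      ≈⟨ sumTo-triangle k G ⟩
        sumTo k (λ p → sumTo (k ∸ p) (G p))
      ≈⟨ sumTo-cong k (λ p p≤k → sym (sumTo-extend k (G p) (m∸n≤m k p) (G≈0 p≤k))) ⟩
        sumTo k (λ p → sumTo k (G p))
      ∎
      where
        G : ℕ → ℕ → Carrier
        G p q = α p * β q * pow L (p ℕ.+ q) k

        G≈0 : ∀ {p} → p ≤ k → ∀ q → k ∸ p < q → G p q ≈ 0#
        G≈0 {p} p≤k q k∸p<q = trans (*-congˡ (pow-vanishes L0 k<p+q)) (zeroʳ _)
          where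
            k<p+q : k < p ℕ.+ q
            k<p+q = ≡.subst (_< p ℕ.+ q) (m+[n∸m]≡n p≤k) (+-monoʳ-< p k∸p<q)

    conv-compose-expand :
      conv (compose α L) (compose β L) k ≈ sumTo k (λ p → sumTo k (λ q → α p * β q * pow L (p ℕ.+ q) k))
    conv-compose-expand = begin
        sumTo k (λ i → compose α L i * compose β L (k ∸ i))
      ≈⟨ sumTo-cong k (λ i i≤k → *-cong (compose-extend L0 α i≤k) (compose-extend L0 β (m∸n≤m k i))) ⟩
        sumTo k (λ i → sumTo k (λ p → α p * pow L p i) * sumTo k (λ q → β q * pow L q (k ∸ i)))
      ≈⟨ sumTo-cong k (λ i _ → trans (*-distribʳ-sumTo k _ _) (sumTo-cong k (λ p _ → *-distribˡ-sumTo k _ _))) ⟩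
        sumTo k (λ i → sumTo k (λ p → sumTo k (λ q → H p q i)))
      ≈⟨ sumTo-comm k k _ ⟩
        sumTo k (λ p → sumTo k (λ i → sumTo k (λ q → H p q i)))
      ≈⟨ sumTo-cong k (λ p _ → sumTo-comm k k _) ⟩
        sumTo k (λ p → sumTo k (λ q → sumTo k (H p q)))
      ≈⟨ sumTo-cong k (λ p _ → sumTo-cong k (λ q _ →
           trans (sumTo-cong k (λ i _ → interchange _ _ _ _)) (sym (*-distribˡ-sumTo k _ _)))) ⟩
        sumTo k (λ p → sumTo k (λ q → α p * β q * conv (pow L p) (pow L q) k))
      ≈⟨ sumTo-cong k (λ p _ → sumTo-cong k (λ q _ → *-congˡ (pow-+ L p q k))) ⟩
        sumTo k (λ p → sumTo k (λ q → α p * β q * pow L (p ℕ.+ q) k))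
      ∎
      where
        H : ℕ → ℕ → ℕ → Carrier
        H p q i = (α p * pow L p i) * (β q * pow L q (k ∸ i))

    compose-conv : compose (conv α β) L k ≈ conv (compose α L) (compose β L) k
    compose-conv = trans compose-conv-expand (sym conv-compose-expand)

  natToR-+ : ∀ m n → natToR (m ℕ.+ n) ≈ natToR m + natToR n
  natToR-+ zero n = sym (+-identityˡ _)
  natToR-+ (suc m) n = trans (+-congˡ (natToR-+ m n)) (sym (+-assoc _ _ _))

  natToR-* : ∀ m n → natToR (m ℕ.* n) ≈ natToR m * natToR n
  natToR-* zero n = sym (zeroˡ _)
  natToR-* (suc m) n = begin
      natToR (n ℕ.+ m ℕ.* n)            ≈⟨ natToR-+ n (m ℕ.* n) ⟩
      natToR n + natToR (m ℕ.* n)       ≈⟨ +-cong (sym (*-identityˡ _)) (natToR-* m n) ⟩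
      1# * natToR n + natToR m * natToR n ≈⟨ sym (distribʳ _ _ _) ⟩
      (1# + natToR m) * natToR n         ∎

  -- The m! in qCoeff is computed by a where-function of Defs, which is out of scope. Unfolding it once
  -- at suc m and with-abstracting its parameter suc m (apart from its argument m) and ℕ._+_ (so that
  -- the argument of natToR stays rigid) makes it the solution of a pattern unification problem for
  -- the metavariable in localFactorial.
  mutual
    localFactorial : (ℕ → Carrier) → ℕ → ℕ → ℕ → ℕ
    localFactorial g j M = _

    qCoeff≈ : ∀ g m j → qCoeff g m j ≈ natToR (m !) * invFact j * pow (logSeries g) j m
    qCoeff≈ g zero j = refl
    qCoeff≈ g (suc m) j with suc m | ℕ._+_
    ... | M | plus = reflexive (≡.cong (λ t → natToR (plus t (m ℕ.* t)) * invFact j * pow (logSeries g) j M)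
                                       (factorial-unique (localFactorial g j M) ≡.refl (λ _ → ≡.refl) m))

  ordinary : (ℕ → Carrier) → ℕ → Carrier
  ordinary f i = f i * invFact i

  K≈!*compose : ∀ g a m → K g a m ≈ natToR (m !) * compose (ordinary a) (logSeries g) m
  K≈!*compose g a m = trans (sumTo-cong m (λ j _ → term j)) (sym (*-distribˡ-sumTo m _ _))
    where
      term : ∀ j → qCoeff g m j * a j ≈ natToR (m !) * (ordinary a j * pow (logSeries g) j m)
      term j = trans (*-congʳ (qCoeff≈ g m j))
        (solve 4 (λ m! j⁻¹ P a → ((m! ⊕ j⁻¹) ⊕ P) ⊕ a ⊜ m! ⊕ ((a ⊕ j⁻¹) ⊕ P)) refl _ _ _ _)

  module Factorials (natToR-suc*inv : ∀ n → natToR (suc n) * inv n ≈ 1#) where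

    !*invFact≈1 : ∀ n → natToR (n !) * invFact n ≈ 1#
    !*invFact≈1 zero = trans (*-identityʳ _) (+-identityʳ _)
    !*invFact≈1 (suc n) = begin
        natToR (suc n ℕ.* n !) * (inv n * invFact n)        ≈⟨ *-congʳ (natToR-* (suc n) (n !)) ⟩
        natToR (suc n) * natToR (n !) * (inv n * invFact n) ≈⟨ interchange _ _ _ _ ⟩
        natToR (suc n) * inv n * (natToR (n !) * invFact n) ≈⟨ *-cong (natToR-suc*inv n) (!*invFact≈1 n) ⟩
        1# * 1#                                             ≈⟨ *-identityˡ _ ⟩
        1#                                                  ∎

    invFact-cancelʳ : ∀ k {x y} → x ≈ natToR (k !) * y → x * invFact k ≈ y
    invFact-cancelʳ k {x} {y} x≈k!y = begin
      x * invFact k                   ≈⟨ *-congʳ x≈k!y ⟩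
      natToR (k !) * y * invFact k    ≈⟨ solve 3 (λ k! y k⁻¹ → (k! ⊕ y) ⊕ k⁻¹ ⊜ (k! ⊕ k⁻¹) ⊕ y) refl _ _ _ ⟩
      natToR (k !) * invFact k * y    ≈⟨ *-congʳ (!*invFact≈1 k) ⟩
      1# * y                          ≈⟨ *-identityˡ y ⟩
      y                               ∎

    C≈!*invFact*invFact : ∀ {k i} → i ≤ k → natToR (k C i) ≈ natToR (k !) * invFact i * invFact (k ∸ i)
    C≈!*invFact*invFact {k} {i} i≤k = sym (begin
        natToR (k !) * invFact i * invFact (k ∸ i)
      ≈⟨ *-congʳ (*-congʳ (reflexive (≡.cong natToR (≡.sym (nCk*[k!*[n∸k]!]≡n! i≤k))))) ⟩
        natToR ((k C i) ℕ.* (i ! ℕ.* (k ∸ i) !)) * invFact i * invFact (k ∸ i)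
      ≈⟨ *-congʳ (*-congʳ (trans (natToR-* (k C i) _) (*-congˡ (natToR-* (i !) ((k ∸ i) !))))) ⟩
        natToR (k C i) * (natToR (i !) * natToR ((k ∸ i) !)) * invFact i * invFact (k ∸ i)
      ≈⟨ solve 5 (λ C i! j! i⁻¹ j⁻¹ → ((C ⊕ (i! ⊕ j!)) ⊕ i⁻¹) ⊕ j⁻¹ ⊜ C ⊕ ((i! ⊕ i⁻¹) ⊕ (j! ⊕ j⁻¹)))
               refl _ _ _ _ _ ⟩
        natToR (k C i) * ((natToR (i !) * invFact i) * (natToR ((k ∸ i) !) * invFact (k ∸ i)))
      ≈⟨ *-congˡ (trans (*-cong (!*invFact≈1 i) (!*invFact≈1 (k ∸ i))) (*-identityˡ 1#)) ⟩
        natToR (k C i) * 1#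
      ≈⟨ *-identityʳ _ ⟩
        natToR (k C i)
      ∎)

    egfMul≈!*conv : ∀ (f h : ℕ → Carrier) k → egfMul f h k ≈ natToR (k !) * conv (ordinary f) (ordinary h) k
    egfMul≈!*conv f h k = trans (sumTo-cong k term) (sym (*-distribˡ-sumTo k _ _))
      where
        term : ∀ i → i ≤ k → natToR (k C i) * f i * h (k ∸ i) ≈ natToR (k !) * (ordinary f i * ordinary h (k ∸ i))
        term i i≤k = trans (*-congʳ (*-congʳ (C≈!*invFact*invFact i≤k)))
          (solve 5 (λ k! i⁻¹ j⁻¹ x y → (((k! ⊕ i⁻¹) ⊕ j⁻¹) ⊕ x) ⊕ y ⊜ k! ⊕ ((x ⊕ i⁻¹) ⊕ (y ⊕ j⁻¹)))
                 refl _ _ _ _ _)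

    ordinary-egfMul : ∀ (f h : ℕ → Carrier) k → ordinary (egfMul f h) k ≈ conv (ordinary f) (ordinary h) k
    ordinary-egfMul f h k = invFact-cancelʳ k (egfMul≈!*conv f h k)

    ordinary-K : ∀ g a m → ordinary (K g a) m ≈ compose (ordinary a) (logSeries g) m
    ordinary-K g a m = invFact-cancelʳ m (K≈!*compose g a m)

mainTheorem11 : ∀ {c ℓ} (R : CommutativeRing c ℓ) (inv : ℕ → CommutativeRing.Carrier R) →
    let open CommutativeRing R
        open Setup R inv
    in (∀ n → natToR (suc n) * inv n ≈ 1#) →
       (g : ℕ → Carrier) → g 0 ≈ 1# →
       (a b cs : ℕ → Carrier) → a 0 ≈ 1# → b 0 ≈ 1# → cs 0 ≈ 1# →
       (∀ k → cs k ≈ egfMul a b k) →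
       ∀ k → K g cs k ≈ egfMul (K g a) (K g b) k
mainTheorem11 R inv natToR-suc*inv g _ a b cs _ _ _ cs≈ab k = begin
    K g cs k
  ≈⟨ K≈!*compose g cs k ⟩
    natToR (k !) * compose (ordinary cs) L k
  ≈⟨ *-congˡ (compose-cong (λ j → trans (*-congʳ (cs≈ab j)) (ordinary-egfMul a b j)) k) ⟩
    natToR (k !) * compose (conv (ordinary a) (ordinary b)) L k
  ≈⟨ *-congˡ (compose-conv refl (ordinary a) (ordinary b) k) ⟩
    natToR (k !) * conv (compose (ordinary a) L) (compose (ordinary b) L) k
  ≈⟨ *-congˡ (conv-cong (sym ∘ ordinary-K g a) (sym ∘ ordinary-K g b) k) ⟩
    natToR (k !) * conv (ordinary (K g a)) (ordinary (K g b)) k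
  ≈⟨ sym (egfMul≈!*conv (K g a) (K g b) k) ⟩
    egfMul (K g a) (K g b) k
  ∎
  where
    open CommutativeRing R
    open Setup R inv
    open SeriesAlgebra R inv
    open Factorials natToR-suc*inv
    open import Relation.Binary.Reasoning.Setoid setoid

    L : ℕ → Carrier
    L = logSeries g
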